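{- Let $\mathcal{C}$ be a set of characters on a taxon set $\mathcal{S}$ and let $A$ be a maximal character of $\mathcal{C}$. Suppose that $T$ is a rooted tree with leaf set $\mathcal{S}$ and no subdivision node that is galled-completable for $\mathcal{C}$ and in which $A$ is split into the clades $A_1$ and $A_2$. Let $\mathcal{X}\subseteq\mathcal{C}$ be the set of characters intersecting both $A_1$ and $A_2$, and suppose that $\mathcal{X}$ is an $(A_1,A_2)$-chain, with ordering $X_1,\dots,X_l$ as in the definition, so that $X_1\cap A_1$ is the bottom of the chain and $A_2$ is its stable side. If $C\in\mathcal{C}\setminus\mathcal{X}$ contains $X_1\cap A_1$ or contains $A_2$, then $C$ is a clade of $T$.
   Context: A network is a finite directed acyclic graph with a unique node of in-degree $0$ (the root); a leaf has in-degree $1$ and out-degree $0$; subdivision nodes are allowed. An underlying cycle is a cycle of the underlying undirected (multi)graph; two are distinct if they use different edge sets. A network is a galled tree if no two distinct underlying cycles share a node. A tree is a network with no underlying cycle; $L_T(v)$ is the set of leaves descending from $v$, called a clade of $T$. An LGT network is a network $N=(V,E_S\cup E_T)$ with a specified partition of its edges into support edges $E_S$ and transfer edges $E_T$ such that $(V,E_S)$ is a tree $\overline{N}$ (the support tree), both endpoints of every transfer edge are incomparable in $\overline{N}$, and every endpoint of a transfer edge has exactly one child in $\overline{N}$. The base tree of $N$ is obtained from $\overline{N}$ by suppressing subdivision nodes. A character is a subset of $\mathcal{S}$; $F_C(N)$ is the set of nodes $v$ such that some leaf descending from $v$ in $\overline{N}$ is not in $C$; $N$ explains $\mathcal{C}$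 if for every $C\in\mathcal{C}$, $N-F_C(N)$ contains a node reaching every leaf of $C$ within $N-F_C(N)$. $T$ is galled-completable for $\mathcal{C}$ if some LGT network that is a galled tree, has leaf set $\mathcal{S}$ and base tree $T$, explains $\mathcal{C}$. A node $v$ of $T$ is a first-appearance (FA) node for $C$ if $L_T(v)\subseteq C$ and either $v$ is the root or its parent $u$ satisfies $L_T(u)\not\subseteq C$. $C$ is split into $X$ and $Y$ in $T$ if $C$ has exactly two FA nodes $x_1,x_2$ with $L_T(x_1)=X$, $L_T(x_2)=Y$. $C\in\mathcal{C}$ is maximal if no $C'\in\mathcal{C}$ satisfies $C\subset C'$. For a partition $\{A_1,A_2\}$ of $A$, the set $\mathcal{X}$ of characters intersecting both $A_1$ and $A_2$ is an $(A_1,A_2)$-chain if its elements can be ordered $X_1,\dots,X_l$ with $X_l=A$, $(X_1\cap A_1)\subset\cdots\subset(X_l\cap A_1)=A_1$, and $X_i\setminus A_1=A_2$ for all $i$; $X_1\cap A_1$ is the bottom and $A_2$ the stable side of the chain. -}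

module Defs where

open import Data.Nat using (ℕ; zero; suc; _≤_)
open import Data.Fin using (Fin; zero; suc; fromℕ; inject₁)
open import Data.Fin.Subset using (Subset; _∈_; _∉_; _⊆_; _⊂_; _∩_; _─_; Nonempty)
open import Data.Bool using (Bool; true; false; T)
open import Data.Product using (Σ; ∃; _×_; _,_; proj₁)
open import Data.Sum using (_⊎_)
open import Data.Unit using (⊤)
open import Data.Empty using (⊥)
open import Relation.Nullary using (¬_)
open import Relation.Binary.PropositionalEquality using (_≡_; _≢_)

-- Directed multigraphs on the vertex set Fin nV with an edge type E
-- (edges are individuals, so parallel edges are allowed).

record Graph : Set₁ where
  field
    nV  : ℕ
    E   : Set
    src : E → Fin nV
    tgt : E → Fin nV

open Graph public

module _ (G : Graph) where

  Vtx : Set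
  Vtx = Fin (nV G)

  data PathIn (P : Vtx → Set) : Vtx → Vtx → Set where
    here : ∀ {v} → P v → PathIn P v v
    step : ∀ {u w} (e : E G) → P u → src G e ≡ u → PathIn P (tgt G e) w → PathIn P u w

  Reach : Vtx → Vtx → Set
  Reach = PathIn (λ _ → ⊤)

  InDeg0 : Vtx → Set
  InDeg0 v = ∀ e → tgt G e ≢ v

  OutDeg0 : Vtx → Set
  OutDeg0 v = ∀ e → src G e ≢ v

  InDeg1 : Vtx → Set
  InDeg1 v = ∃ λ e → tgt G e ≡ v × (∀ e′ → tgt G e′ ≡ v → e′ ≡ e)

  OutDeg1 : Vtx → Set
  OutDeg1 v = ∃ λ e → src G e ≡ v × (∀ e′ → src G e′ ≡ v → e′ ≡ e)

  IsLeaf : Vtx → Set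
  IsLeaf v = InDeg1 v × OutDeg0 v

  IsSubdiv : Vtx → Set
  IsSubdiv v = InDeg1 v × OutDeg1 v

  IsRoot : Vtx → Set
  IsRoot = InDeg0

  Acyclic : Set
  Acyclic = ∀ e → ¬ Reach (tgt G e) (src G e)

  IsNetwork : Set
  IsNetwork = Acyclic × (∃ λ r → IsRoot r × (∀ v → IsRoot v → v ≡ r))

  Joins : E G → Vtx → Vtx → Set
  Joins e u v = (src G e ≡ u × tgt G e ≡ v) ⊎ (src G e ≡ v × tgt G e ≡ u)

  record Cycle : Set where
    field
      len    : ℕ
      len≥2  : 2 ≤ len
      vs     : Fin (suc len) → Vtx
      es     : Fin len → E G
      closed : vs (fromℕ len) ≡ vs zero
      vinj   : ∀ i j → vs (inject₁ i) ≡ vs (inject₁ j) → i ≡ j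
      einj   : ∀ i j → es i ≡ es j → i ≡ j
      link   : ∀ i → Joins (es i) (vs (inject₁ i)) (vs (suc i))

  OnCycle : Vtx → Cycle → Set
  OnCycle v c = ∃ λ i → Cycle.vs c i ≡ v

  EdgeOf : E G → Cycle → Set
  EdgeOf e c = ∃ λ i → Cycle.es c i ≡ e

  -- two underlying cycles are the same iff they use the same edge set
  SameEdges : Cycle → Cycle → Set
  SameEdges c₁ c₂ = ∀ e → (EdgeOf e c₁ → EdgeOf e c₂) × (EdgeOf e c₂ → EdgeOf e c₁)

  IsGalledTree : Set
  IsGalledTree = IsNetwork ×
    (∀ c₁ c₂ → ¬ (¬ SameEdges c₁ c₂ × (∃ λ v → OnCycle v c₁ × OnCycle v c₂)))

  IsTree : Set
  IsTree = IsNetwork × (Cycle → ⊥)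

  HasLeafSet : ∀ {n} → (Fin n → Vtx) → Set
  HasLeafSet {n} leaf =
    (∀ x y → leaf x ≡ leaf y → x ≡ y) ×
    (∀ x → IsLeaf (leaf x)) ×
    (∀ v → IsLeaf v → ∃ λ x → leaf x ≡ v)

  data SPath : Vtx → Vtx → Set where
    one  : ∀ {u w} (e : E G) → src G e ≡ u → tgt G e ≡ w → SPath u w
    more : ∀ {u w} (e : E G) → src G e ≡ u → IsSubdiv (tgt G e) → SPath (tgt G e) w → SPath u w

record LNet (n : ℕ) : Set where
  field
    nVert : ℕ
    nEdge : ℕ
    s t   : Fin nEdge → Fin nVert
    leaf  : Fin n → Fin nVert

open LNet public

graph : ∀ {n} → LNet n → Graph
graph N = record { nV = nVert N ; E = Fin (nEdge N) ; src = s N ; tgt = t N }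

supportGraph : ∀ {n} (N : LNet n) → (Fin (nEdge N) → Bool) → Graph
supportGraph N isS = record
  { nV = nVert N ; E = Σ (Fin (nEdge N)) (λ e → T (isS e))
  ; src = λ e → s N (proj₁ e) ; tgt = λ e → t N (proj₁ e) }

module _ {n : ℕ} (N : LNet n) (isS : Fin (nEdge N) → Bool) where

  private
    Nb = supportGraph N isS

  -- LGT network: support edges = those with isS e ≡ true, transfer = false
  IsLGT : Set
  IsLGT = IsNetwork (graph N) × IsTree Nb ×
    (∀ e → isS e ≡ false →
       (¬ Reach Nb (s N e) (t N e) × ¬ Reach Nb (t N e) (s N e)) ×
       OutDeg1 Nb (s N e) × OutDeg1 Nb (t N e))

  F : Subset n → Fin (nVert N) → Set
  F C v = ∃ λ x → x ∉ C × Reach Nb v (leaf N x)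

  Explains : (Subset n → Set) → Set
  Explains 𝒞 = ∀ C → 𝒞 C →
    ∃ λ w → ¬ F C w × (∀ x → x ∈ C → PathIn (graph N) (λ v → ¬ F C v) w (leaf N x))

  -- T is (isomorphic, leaf labels preserved, to) the tree obtained from
  -- the support tree by suppressing all subdivision nodes
  HasBaseTree : LNet n → Set
  HasBaseTree Tr = ∃ λ (φ : Fin (nVert Tr) → Fin (nVert N)) →
    (∀ u v → φ u ≡ φ v → u ≡ v) ×
    (∀ v → ¬ IsSubdiv Nb (φ v)) ×
    (∀ w → ¬ IsSubdiv Nb w → ∃ λ v → φ v ≡ w) ×
    (∀ u v → ((∃ λ e → s Tr e ≡ u × t Tr e ≡ v) → SPath Nb (φ u) (φ v)) ×
             (SPath Nb (φ u) (φ v) → ∃ λ e → s Tr e ≡ u × t Tr e ≡ v)) ×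
    (∀ x → φ (leaf Tr x) ≡ leaf N x)

GalledCompletable : ∀ {n} → LNet n → (Subset n → Set) → Set
GalledCompletable {n} Tr 𝒞 = ∃ λ (N : LNet n) → ∃ λ (isS : Fin (nEdge N) → Bool) →
  IsLGT N isS × IsGalledTree (graph N) × HasLeafSet (graph N) (leaf N) ×
  HasBaseTree N isS Tr × Explains N isS 𝒞

module _ {n : ℕ} (Tr : LNet n) where

  L : Fin (nVert Tr) → Subset n → Set
  L v X = ∀ x → (x ∈ X → Reach (graph Tr) v (leaf Tr x)) × (Reach (graph Tr) v (leaf Tr x) → x ∈ X)

  LSub : Fin (nVert Tr) → Subset n → Set
  LSub v C = ∀ x → Reach (graph Tr) v (leaf Tr x) → x ∈ C

  IsClade : Subset n → Set
  IsClade C = ∃ λ v → L v C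

  IsFA : Subset n → Fin (nVert Tr) → Set
  IsFA C v = LSub v C ×
    (IsRoot (graph Tr) v ⊎ (∃ λ e → t Tr e ≡ v × ¬ LSub (s Tr e) C))

  SplitInto : Subset n → Subset n → Subset n → Set
  SplitInto C X Y = ∃ λ x₁ → ∃ λ x₂ → x₁ ≢ x₂ × IsFA C x₁ × IsFA C x₂ ×
    (∀ v → IsFA C v → v ≡ x₁ ⊎ v ≡ x₂) × L x₁ X × L x₂ Y

  NoSubdiv : Set
  NoSubdiv = ∀ v → ¬ IsSubdiv (graph Tr) v

IsMaximal : ∀ {n} → (Subset n → Set) → Subset n → Set
IsMaximal 𝒞 A = 𝒞 A × (∀ C → 𝒞 C → ¬ (A ⊂ C))

Crossing : ∀ {n} → (Subset n → Set) → Subset n → Subset n → Subset n → Set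
Crossing 𝒞 A₁ A₂ C = 𝒞 C × Nonempty (C ∩ A₁) × Nonempty (C ∩ A₂)

-- X : Fin (suc k) → Subset n is an ordering X₁ … X_l (l = suc k)
-- witnessing that 𝒳 is an (A₁,A₂)-chain, with A = A₁ ∪ A₂
IsChainOrdering : ∀ {n} → (Subset n → Set) → Subset n → Subset n → Subset n →
                  (k : ℕ) → (Fin (suc k) → Subset n) → Set
IsChainOrdering 𝒞 A A₁ A₂ k X =
  (∀ i → Crossing 𝒞 A₁ A₂ (X i)) ×
  (∀ C → Crossing 𝒞 A₁ A₂ C → ∃ λ i → X i ≡ C) ×
  (∀ i j → X i ≡ X j → i ≡ j) ×
  X (fromℕ k) ≡ A ×
  (∀ (i : Fin k) → (X (inject₁ i) ∩ A₁) ⊂ (X (suc i) ∩ A₁)) ×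
  (X (fromℕ k) ∩ A₁) ≡ A₁ ×
  (∀ i → (X i ─ A₁) ≡ A₂)

-- Suppose C is not a clade. Of the two sides of the split of A, C misses one, call it S, and
-- meets the character X that straddles S: for A₂ ⊆ C take S = A₁ and X = A, for X₁ ∩ A₁ ⊆ C
-- take S = A₂ and X = X₁ (C avoids S, as otherwise C would cross the split and lie in the
-- chain). In a galled-tree completion, explaining X forces a transfer edge out of the part of
-- the support tree below S, and its outer endpoint only sees leaves of C. Let y be the
-- first-appearance node of C above such a leaf; since C is not a clade, explaining C forces a
-- second transfer edge into the part below y. The underlying cycles through the two transfer
-- edges are distinct but share the image of the parent of y, contradicting galledness.
-- The argument is classical and runs in the double-negation monad; being a clade is decidable.

module Submission where

open import Defs
open import Data.Bool using (Bool; true; false; T)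
open import Data.Empty using (⊥; ⊥-elim)
open import Data.Fin using (Fin; zero; suc; fromℕ; inject₁; _≟_)
open import Data.Fin.Properties using (any?; all?; injective⇒≤)
open import Data.Fin.Subset using (Subset; _∈_; _∉_; _⊆_; _∩_; _─_)
open import Data.Fin.Subset.Properties using (_∈?_; x∈p∩q⁻; x∈p∩q⁺)
open import Data.Nat using (ℕ; zero; suc; _+_; _≤_; _<_; z≤n; s≤s)
open import Data.Nat.Properties using (+-suc; +-identityʳ; m≤n+m; n≤1+n; n<1+n; ≤-refl; ≤-trans; <⇒≱)
open import Data.Product using (Σ; ∃; _×_; _,_; proj₁; proj₂)
open import Data.Sum using (_⊎_; inj₁; inj₂; [_,_]′)
open import Data.Unit using (⊤; tt)
open import Data.Vec using (_∷_; here; there)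
open import Effect.Monad using (RawMonad)
open import Function using (_∘_)
open import Level using (0ℓ)
open import Relation.Binary.PropositionalEquality using (_≡_; _≢_; refl; sym; trans; cong; subst)
open import Relation.Nullary using (¬_; Dec; yes; no)
open import Relation.Nullary.Decidable using (decidable-stable; ¬¬-excluded-middle; map′; _×-dec_; _→-dec_)
open import Relation.Nullary.Negation using (¬¬-Monad)

open RawMonad (¬¬-Monad {a = 0ℓ}) using (return; _>>=_; _<$>_)

-- Directed paths

module Paths (G : Graph) where

  infix 4 _⇝_ _∈ᵥ_ _∈ₑ_
  infixr 5 _++_

  _⇝_ : Vtx G → Vtx G → Set
  _⇝_ = Reach G

  length : ∀ {u v} → u ⇝ v → ℕ
  length (here _) = 0
  length (step _ _ _ p) = suc (length p)

  _∈ᵥ_ : ∀ {u v} → Vtx G → u ⇝ v → Set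
  q ∈ᵥ here {v} _ = q ≡ v
  q ∈ᵥ step {u} _ _ _ p = q ≡ u ⊎ q ∈ᵥ p

  _∈ₑ_ : ∀ {u v} → E G → u ⇝ v → Set
  f ∈ₑ here _ = ⊥
  f ∈ₑ step e _ _ p = f ≡ e ⊎ f ∈ₑ p

  head : ∀ {P u v} → PathIn G P u v → P u
  head (here p) = p
  head (step _ p _ _) = p

  _++_ : ∀ {u v w} → u ⇝ v → v ⇝ w → u ⇝ w
  here _ ++ q = q
  step e _ eq p ++ q = step e tt eq (p ++ q)

  length-++ : ∀ {u v w} (p : u ⇝ v) (q : v ⇝ w) → length (p ++ q) ≡ length p + length q
  length-++ (here _) q = refl
  length-++ (step _ _ _ p) q = cong suc (length-++ p q)

  edge-path : ∀ e → src G e ⇝ tgt G e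
  edge-path e = step e tt refl (here tt)

  snoc : ∀ {u v} → u ⇝ v → ∀ e → src G e ≡ v → u ⇝ tgt G e
  snoc p e eq = p ++ step e tt eq (here tt)

  length-snoc : ∀ {u v} (p : u ⇝ v) e (eq : src G e ≡ v) → length (snoc p e eq) ≡ suc (length p)
  length-snoc p e eq = trans (length-++ p _) (trans (+-suc (length p) 0) (cong suc (+-identityʳ (length p))))

  start-∈ᵥ : ∀ {u v} (p : u ⇝ v) → u ∈ᵥ p
  start-∈ᵥ (here _) = refl
  start-∈ᵥ (step _ _ _ _) = inj₁ refl

  end-∈ᵥ : ∀ {u v} (p : u ⇝ v) → v ∈ᵥ p
  end-∈ᵥ (here _) = refl
  end-∈ᵥ (step _ _ _ p) = inj₂ (end-∈ᵥ p)

  ∈ₑ⇒src-∈ᵥ : ∀ {u v f} (p : u ⇝ v) → f ∈ₑ p → src G f ∈ᵥ p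
  ∈ₑ⇒src-∈ᵥ (step _ _ eq _) (inj₁ refl) = inj₁ eq
  ∈ₑ⇒src-∈ᵥ (step _ _ _ p) (inj₂ f∈p) = inj₂ (∈ₑ⇒src-∈ᵥ p f∈p)

  ∈ₑ⇒tgt-∈ᵥ : ∀ {u v f} (p : u ⇝ v) → f ∈ₑ p → tgt G f ∈ᵥ p
  ∈ₑ⇒tgt-∈ᵥ (step _ _ _ p) (inj₁ refl) = inj₂ (start-∈ᵥ p)
  ∈ₑ⇒tgt-∈ᵥ (step _ _ _ p) (inj₂ f∈p) = inj₂ (∈ₑ⇒tgt-∈ᵥ p f∈p)

  prefix : ∀ {u v q} (p : u ⇝ v) → q ∈ᵥ p → u ⇝ q
  prefix (here _) refl = here tt
  prefix (step _ _ _ _) (inj₁ refl) = here tt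
  prefix (step e _ eq p) (inj₂ q∈p) = step e tt eq (prefix p q∈p)

  suffix : ∀ {u v q} (p : u ⇝ v) → q ∈ᵥ p → Σ (q ⇝ v) λ s → length s ≤ length p
  suffix (here _) refl = here tt , z≤n
  suffix p@(step _ _ _ _) (inj₁ refl) = p , ≤-refl
  suffix (step _ _ _ p) (inj₂ q∈p) with suffix p q∈p
  ... | s , s≤p = s , ≤-trans s≤p (n≤1+n (length p))

  last-edge : ∀ {u v} (p : u ⇝ v) → u ≡ v ⊎ ∃ λ e → u ⇝ src G e × tgt G e ≡ v
  last-edge (here _) = inj₁ refl
  last-edge (step e _ eq p) with last-edge p
  ... | inj₁ refl = inj₂ (e , subst (_ ⇝_) (sym eq) (here tt) , refl)
  ... | inj₂ (e′ , p′ , eq′) = inj₂ (e′ , step e tt eq p′ , eq′)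

  SPath⇒⇝ : ∀ {u w} → SPath G u w → u ⇝ w
  SPath⇒⇝ (one e eq₁ eq₂) = step e tt eq₁ (subst (tgt G e ⇝_) eq₂ (here tt))
  SPath⇒⇝ (more e eq _ p) = step e tt eq (SPath⇒⇝ p)

  SPath-snoc : ∀ {u q} → SPath G u q → IsSubdiv G q → ∀ e → src G e ≡ q → SPath G u (tgt G e)
  SPath-snoc (one e₀ eq₁ eq₂) q-sub e eq =
    more e₀ eq₁ (subst (IsSubdiv G) (sym eq₂) q-sub) (one e (trans eq (sym eq₂)) refl)
  SPath-snoc (more e₀ eq₁ sub p) q-sub e eq = more e₀ eq₁ sub (SPath-snoc p q-sub e eq)

  -- The subdivision nodes along sp have unique out-edges, so a path out of r follows sp.
  SPath-forced : ∀ {r w q} → SPath G r w → IsSubdiv G r → r ⇝ q → ¬ IsSubdiv G q → w ⇝ q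
  SPath-forced sp r-sub (here _) q-nsub = ⊥-elim (q-nsub r-sub)
  SPath-forced {q = q} (one e₀ eq₁ eq₂) (_ , _ , _ , uniq) (step e _ eq p) _ =
    subst (_⇝ q) (trans (cong (tgt G) (trans (uniq e eq) (sym (uniq e₀ eq₁)))) eq₂) p
  SPath-forced {q = q} (more e₀ eq₁ sub sp) (_ , _ , _ , uniq) (step e _ eq p) q-nsub =
    SPath-forced sp sub (subst (_⇝ q) (cong (tgt G) (trans (uniq e eq) (sym (uniq e₀ eq₁)))) p) q-nsub

  exit-edge : ∀ {Q S : Vtx G → Set} {u v} → PathIn G Q u v → S u → ¬ S v →
              ¬ ¬ (∃ λ e → Q (src G e) × Q (tgt G e) × S (src G e) × ¬ S (tgt G e))
  exit-edge (here _) su ¬sv = ⊥-elim (¬sv su)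
  exit-edge {Q} {S} (step e qu eq p) su ¬sv = do
    no ¬st ← ¬¬-excluded-middle {A = S (tgt G e)}
      where yes st → exit-edge p st ¬sv
    return (e , subst Q (sym eq) qu , head p , subst S (sym eq) su , ¬st)

  entry-edge : ∀ {Q S : Vtx G → Set} {u v} → PathIn G Q u v → ¬ S u → S v →
               ¬ ¬ (∃ λ e → Q (src G e) × Q (tgt G e) × ¬ S (src G e) × S (tgt G e))
  entry-edge (here _) ¬su sv = ⊥-elim (¬su sv)
  entry-edge {Q} {S} (step e qu eq p) ¬su sv = do
    yes st ← ¬¬-excluded-middle {A = S (tgt G e)}
      where no ¬st → entry-edge p ¬st sv
    return (e , subst Q (sym eq) qu , head p , (λ ss → ¬su (subst S eq ss)) , st)

  -- Undirected walks and cycles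

  data Walk : Vtx G → Vtx G → ℕ → Set where
    nil  : ∀ {v} → Walk v v 0
    cons : ∀ {u w v k} (e : E G) → Joins G e u w → Walk w v k → Walk u v (suc k)

  infix 4 _∈ʷ_ _∈ʷₑ_
  infixr 5 _++ʷ_

  vertexAt : ∀ {u v k} → Walk u v k → Fin (suc k) → Vtx G
  vertexAt {v = v} nil zero = v
  vertexAt (cons {u} _ _ _) zero = u
  vertexAt (cons _ _ w) (suc i) = vertexAt w i

  edgeAt : ∀ {u v k} → Walk u v k → Fin k → E G
  edgeAt (cons e _ _) zero = e
  edgeAt (cons _ _ w) (suc i) = edgeAt w i

  -- every vertex of the walk except the last one
  _∈ʷ_ : ∀ {u v k} → Vtx G → Walk u v k → Set
  q ∈ʷ nil = ⊥
  q ∈ʷ cons {u} _ _ w = q ≡ u ⊎ q ∈ʷ w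

  _∈ʷₑ_ : ∀ {u v k} → E G → Walk u v k → Set
  f ∈ʷₑ nil = ⊥
  f ∈ʷₑ cons e _ w = f ≡ e ⊎ f ∈ʷₑ w

  DistinctVertices : ∀ {u v k} → Walk u v k → Set
  DistinctVertices nil = ⊤
  DistinctVertices (cons {u} _ _ w) = ¬ u ∈ʷ w × DistinctVertices w

  DistinctEdges : ∀ {u v k} → Walk u v k → Set
  DistinctEdges nil = ⊤
  DistinctEdges (cons e _ w) = ¬ e ∈ʷₑ w × DistinctEdges w

  vertexAt-start : ∀ {u v k} (w : Walk u v k) → vertexAt w zero ≡ u
  vertexAt-start nil = refl
  vertexAt-start (cons _ _ _) = refl

  vertexAt-end : ∀ {u v k} (w : Walk u v k) → vertexAt w (fromℕ k) ≡ v
  vertexAt-end nil = refl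
  vertexAt-end (cons _ _ w) = vertexAt-end w

  vertexAt-joins : ∀ {u v k} (w : Walk u v k) (i : Fin k) →
                   Joins G (edgeAt w i) (vertexAt w (inject₁ i)) (vertexAt w (suc i))
  vertexAt-joins (cons e j w) zero = subst (Joins G e _) (sym (vertexAt-start w)) j
  vertexAt-joins (cons _ _ w) (suc i) = vertexAt-joins w i

  vertexAt-∈ʷ : ∀ {u v k} (w : Walk u v k) (i : Fin k) → vertexAt w (inject₁ i) ∈ʷ w
  vertexAt-∈ʷ (cons _ _ _) zero = inj₁ refl
  vertexAt-∈ʷ (cons _ _ w) (suc i) = inj₂ (vertexAt-∈ʷ w i)

  ∈ʷ⇒vertexAt : ∀ {u v k q} (w : Walk u v k) → q ∈ʷ w → ∃ λ i → vertexAt w (inject₁ i) ≡ q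
  ∈ʷ⇒vertexAt (cons _ _ _) (inj₁ refl) = zero , refl
  ∈ʷ⇒vertexAt (cons _ _ w) (inj₂ q∈w) with ∈ʷ⇒vertexAt w q∈w
  ... | i , eq = suc i , eq

  edgeAt-∈ʷₑ : ∀ {u v k} (w : Walk u v k) (i : Fin k) → edgeAt w i ∈ʷₑ w
  edgeAt-∈ʷₑ (cons _ _ _) zero = inj₁ refl
  edgeAt-∈ʷₑ (cons _ _ w) (suc i) = inj₂ (edgeAt-∈ʷₑ w i)

  ∈ʷₑ⇒edgeAt : ∀ {u v k f} (w : Walk u v k) → f ∈ʷₑ w → ∃ λ i → edgeAt w i ≡ f
  ∈ʷₑ⇒edgeAt (cons _ _ _) (inj₁ refl) = zero , refl
  ∈ʷₑ⇒edgeAt (cons _ _ w) (inj₂ f∈w) with ∈ʷₑ⇒edgeAt w f∈w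
  ... | i , eq = suc i , eq

  vertexAt-injective : ∀ {u v k} (w : Walk u v k) → DistinctVertices w →
                       ∀ i j → vertexAt w (inject₁ i) ≡ vertexAt w (inject₁ j) → i ≡ j
  vertexAt-injective (cons _ _ _) _ zero zero _ = refl
  vertexAt-injective (cons _ _ w) (u∉w , _) zero (suc j) eq =
    ⊥-elim (u∉w (subst (_∈ʷ w) (sym eq) (vertexAt-∈ʷ w j)))
  vertexAt-injective (cons _ _ w) (u∉w , _) (suc i) zero eq =
    ⊥-elim (u∉w (subst (_∈ʷ w) eq (vertexAt-∈ʷ w i)))
  vertexAt-injective (cons _ _ w) (_ , dv) (suc i) (suc j) eq = cong suc (vertexAt-injective w dv i j eq)

  edgeAt-injective : ∀ {u v k} (w : Walk u v k) → DistinctEdges w → ∀ i j → edgeAt w i ≡ edgeAt w j → i ≡ j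
  edgeAt-injective (cons _ _ _) _ zero zero _ = refl
  edgeAt-injective (cons _ _ w) (e∉w , _) zero (suc j) eq =
    ⊥-elim (e∉w (subst (_∈ʷₑ w) (sym eq) (edgeAt-∈ʷₑ w j)))
  edgeAt-injective (cons _ _ w) (e∉w , _) (suc i) zero eq =
    ⊥-elim (e∉w (subst (_∈ʷₑ w) eq (edgeAt-∈ʷₑ w i)))
  edgeAt-injective (cons _ _ w) (_ , de) (suc i) (suc j) eq = cong suc (edgeAt-injective w de i j eq)

  walk⇒cycle : ∀ {v k} (w : Walk v v k) → 2 ≤ k → DistinctVertices w → DistinctEdges w → Cycle G
  walk⇒cycle {k = k} w 2≤k dv de = record
    { len = k ; len≥2 = 2≤k ; vs = vertexAt w ; es = edgeAt w
    ; closed = trans (vertexAt-end w) (sym (vertexAt-start w))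
    ; vinj = vertexAt-injective w dv ; einj = edgeAt-injective w de ; link = vertexAt-joins w }

  _++ʷ_ : ∀ {u v x k m} → Walk u v k → Walk v x m → Walk u x (k + m)
  nil ++ʷ w₂ = w₂
  cons e j w₁ ++ʷ w₂ = cons e j (w₁ ++ʷ w₂)

  ∈ʷ-++⁻ : ∀ {u v x k m q} (w₁ : Walk u v k) (w₂ : Walk v x m) → q ∈ʷ w₁ ++ʷ w₂ → q ∈ʷ w₁ ⊎ q ∈ʷ w₂
  ∈ʷ-++⁻ nil w₂ q∈ = inj₂ q∈
  ∈ʷ-++⁻ (cons _ _ _) w₂ (inj₁ eq) = inj₁ (inj₁ eq)
  ∈ʷ-++⁻ (cons _ _ w₁) w₂ (inj₂ q∈) with ∈ʷ-++⁻ w₁ w₂ q∈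
  ... | inj₁ q∈w₁ = inj₁ (inj₂ q∈w₁)
  ... | inj₂ q∈w₂ = inj₂ q∈w₂

  ∈ʷ-++ˡ : ∀ {u v x k m q} (w₁ : Walk u v k) (w₂ : Walk v x m) → q ∈ʷ w₁ → q ∈ʷ w₁ ++ʷ w₂
  ∈ʷ-++ˡ (cons _ _ _) w₂ (inj₁ eq) = inj₁ eq
  ∈ʷ-++ˡ (cons _ _ w₁) w₂ (inj₂ q∈) = inj₂ (∈ʷ-++ˡ w₁ w₂ q∈)

  ∈ʷ-++ʳ : ∀ {u v x k m q} (w₁ : Walk u v k) (w₂ : Walk v x m) → q ∈ʷ w₂ → q ∈ʷ w₁ ++ʷ w₂
  ∈ʷ-++ʳ nil w₂ q∈ = q∈
  ∈ʷ-++ʳ (cons _ _ w₁) w₂ q∈ = inj₂ (∈ʷ-++ʳ w₁ w₂ q∈)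

  ∈ʷₑ-++⁻ : ∀ {u v x k m f} (w₁ : Walk u v k) (w₂ : Walk v x m) → f ∈ʷₑ w₁ ++ʷ w₂ → f ∈ʷₑ w₁ ⊎ f ∈ʷₑ w₂
  ∈ʷₑ-++⁻ nil w₂ f∈ = inj₂ f∈
  ∈ʷₑ-++⁻ (cons _ _ _) w₂ (inj₁ eq) = inj₁ (inj₁ eq)
  ∈ʷₑ-++⁻ (cons _ _ w₁) w₂ (inj₂ f∈) with ∈ʷₑ-++⁻ w₁ w₂ f∈
  ... | inj₁ f∈w₁ = inj₁ (inj₂ f∈w₁)
  ... | inj₂ f∈w₂ = inj₂ f∈w₂

  ∈ʷₑ-++ˡ : ∀ {u v x k m f} (w₁ : Walk u v k) (w₂ : Walk v x m) → f ∈ʷₑ w₁ → f ∈ʷₑ w₁ ++ʷ w₂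
  ∈ʷₑ-++ˡ (cons _ _ _) w₂ (inj₁ eq) = inj₁ eq
  ∈ʷₑ-++ˡ (cons _ _ w₁) w₂ (inj₂ f∈) = inj₂ (∈ʷₑ-++ˡ w₁ w₂ f∈)

  ∈ʷₑ-++ʳ : ∀ {u v x k m f} (w₁ : Walk u v k) (w₂ : Walk v x m) → f ∈ʷₑ w₂ → f ∈ʷₑ w₁ ++ʷ w₂
  ∈ʷₑ-++ʳ nil w₂ f∈ = f∈
  ∈ʷₑ-++ʳ (cons _ _ w₁) w₂ f∈ = inj₂ (∈ʷₑ-++ʳ w₁ w₂ f∈)

  DistinctVertices-++ : ∀ {u v x k m} (w₁ : Walk u v k) (w₂ : Walk v x m) →
    DistinctVertices w₁ → DistinctVertices w₂ → (∀ q → q ∈ʷ w₁ → q ∈ʷ w₂ → ⊥) →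
    DistinctVertices (w₁ ++ʷ w₂)
  DistinctVertices-++ nil w₂ _ dv₂ _ = dv₂
  DistinctVertices-++ (cons _ _ w₁) w₂ (u∉w₁ , dv₁) dv₂ disjoint =
    [ u∉w₁ , disjoint _ (inj₁ refl) ]′ ∘ ∈ʷ-++⁻ w₁ w₂ ,
    DistinctVertices-++ w₁ w₂ dv₁ dv₂ (λ q q∈w₁ → disjoint q (inj₂ q∈w₁))

  DistinctEdges-++ : ∀ {u v x k m} (w₁ : Walk u v k) (w₂ : Walk v x m) →
    DistinctEdges w₁ → DistinctEdges w₂ → (∀ f → f ∈ʷₑ w₁ → f ∈ʷₑ w₂ → ⊥) →
    DistinctEdges (w₁ ++ʷ w₂)
  DistinctEdges-++ nil w₂ _ de₂ _ = de₂
  DistinctEdges-++ (cons _ _ w₁) w₂ (e∉w₁ , de₁) de₂ disjoint =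
    [ e∉w₁ , disjoint _ (inj₁ refl) ]′ ∘ ∈ʷₑ-++⁻ w₁ w₂ ,
    DistinctEdges-++ w₁ w₂ de₁ de₂ (λ f f∈w₁ → disjoint f (inj₂ f∈w₁))

  forward : ∀ {u v} (p : u ⇝ v) → Walk u v (length p)
  forward (here _) = nil
  forward (step e _ eq p) = cons e (inj₁ (eq , refl)) (forward p)

  backLength : ∀ {u v} → u ⇝ v → ℕ
  backLength (here _) = 0
  backLength (step _ _ _ p) = backLength p + 1

  backward : ∀ {u v} (p : u ⇝ v) → Walk v u (backLength p)
  backward (here _) = nil
  backward (step e _ eq p) = backward p ++ʷ cons e (inj₂ (eq , refl)) nil

  InTail : ∀ {u v} → Vtx G → u ⇝ v → Set
  InTail q (here _) = ⊥
  InTail q (step _ _ _ p) = q ∈ᵥ p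

  InTail⇒∈ᵥ : ∀ {u v q} (p : u ⇝ v) → InTail q p → q ∈ᵥ p
  InTail⇒∈ᵥ (step _ _ _ _) q∈ = inj₂ q∈

  ∈ᵥ⇒start⊎InTail : ∀ {u v q} (p : u ⇝ v) → q ∈ᵥ p → q ≡ u ⊎ InTail q p
  ∈ᵥ⇒start⊎InTail (here _) refl = inj₁ refl
  ∈ᵥ⇒start⊎InTail (step _ _ _ _) (inj₁ eq) = inj₁ eq
  ∈ᵥ⇒start⊎InTail (step _ _ _ _) (inj₂ q∈) = inj₂ q∈

  ∈ʷ-forward⁻ : ∀ {u v q} (p : u ⇝ v) → q ∈ʷ forward p → q ∈ᵥ p
  ∈ʷ-forward⁻ (step _ _ _ _) (inj₁ eq) = inj₁ eq
  ∈ʷ-forward⁻ (step _ _ _ p) (inj₂ q∈) = inj₂ (∈ʷ-forward⁻ p q∈)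

  ∈ʷ-forward⁺ : ∀ {u v q} (p : u ⇝ v) → q ∈ᵥ p → q ∈ʷ forward p ⊎ q ≡ v
  ∈ʷ-forward⁺ (here _) refl = inj₂ refl
  ∈ʷ-forward⁺ (step _ _ _ _) (inj₁ eq) = inj₁ (inj₁ eq)
  ∈ʷ-forward⁺ (step _ _ _ p) (inj₂ q∈) with ∈ʷ-forward⁺ p q∈
  ... | inj₁ q∈fw = inj₁ (inj₂ q∈fw)
  ... | inj₂ eq = inj₂ eq

  ∈ʷ-backward⁻ : ∀ {u v q} (p : u ⇝ v) → q ∈ʷ backward p → InTail q p
  ∈ʷ-backward⁻ (step e _ eq p) q∈ with ∈ʷ-++⁻ (backward p) (cons e (inj₂ (eq , refl)) nil) q∈
  ... | inj₁ q∈bw = InTail⇒∈ᵥ p (∈ʷ-backward⁻ p q∈bw)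
  ... | inj₂ (inj₁ refl) = start-∈ᵥ p

  ∈ʷ-backward⁺ : ∀ {u v q} (p : u ⇝ v) → InTail q p → q ∈ʷ backward p
  ∈ʷ-backward⁺ (step e _ eq p) q∈ with ∈ᵥ⇒start⊎InTail p q∈
  ... | inj₁ refl = ∈ʷ-++ʳ (backward p) (cons e (inj₂ (eq , refl)) nil) (inj₁ refl)
  ... | inj₂ q∈tail = ∈ʷ-++ˡ (backward p) (cons e (inj₂ (eq , refl)) nil) (∈ʷ-backward⁺ p q∈tail)

  ∈ʷₑ-forward⁻ : ∀ {u v f} (p : u ⇝ v) → f ∈ʷₑ forward p → f ∈ₑ p
  ∈ʷₑ-forward⁻ (step _ _ _ _) (inj₁ eq) = inj₁ eq
  ∈ʷₑ-forward⁻ (step _ _ _ p) (inj₂ f∈) = inj₂ (∈ʷₑ-forward⁻ p f∈)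

  ∈ʷₑ-backward⁻ : ∀ {u v f} (p : u ⇝ v) → f ∈ʷₑ backward p → f ∈ₑ p
  ∈ʷₑ-backward⁻ (step e _ eq p) f∈ with ∈ʷₑ-++⁻ (backward p) (cons e (inj₂ (eq , refl)) nil) f∈
  ... | inj₁ f∈bw = inj₂ (∈ʷₑ-backward⁻ p f∈bw)
  ... | inj₂ (inj₁ refl) = inj₁ refl

  record Fork (a b : Vtx G) : Set where
    constructor fork
    field
      {root}   : Vtx G
      left     : root ⇝ a
      right    : root ⇝ b
      disjoint : ∀ q → q ∈ᵥ left → q ∈ᵥ right → q ≡ root

  -- Cut both paths at a common vertex as long as the left one has a later such vertex.
  ¬¬-fork : ∀ {z a b} → z ⇝ a → z ⇝ b → ¬ ¬ Fork a b
  ¬¬-fork P Q = go (length P) P ≤-refl Q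
    where
    go : ∀ {z a b} (bound : ℕ) (P : z ⇝ a) → length P ≤ bound → z ⇝ b → ¬ ¬ Fork a b
    go _ (here _) _ Q = return (fork (here tt) Q λ _ q≡z _ → q≡z)
    go (suc bound) P@(step _ _ _ P′) (s≤s P′≤bound) Q = do
      no no-meet ← ¬¬-excluded-middle {A = ∃ λ q → q ∈ᵥ P′ × q ∈ᵥ Q}
        where yes (q , q∈P′ , q∈Q) → let (P″ , P″≤P′) = suffix P′ q∈P′ in
                go bound P″ (≤-trans P″≤P′ P′≤bound) (proj₁ (suffix Q q∈Q))
      return (fork P Q λ { q (inj₁ q≡z) _ → q≡z ; q (inj₂ q∈P′) q∈Q → ⊥-elim (no-meet (q , q∈P′ , q∈Q)) })

  -- Acyclic graphs

  module Acyclicity (acyclic : Acyclic G) where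

    no-back-path : ∀ {e u} → src G e ≡ u → tgt G e ⇝ u → ⊥
    no-back-path {e} refl p = acyclic e p

    DistinctVertices-forward : ∀ {u v} (p : u ⇝ v) → DistinctVertices (forward p)
    DistinctVertices-forward (here _) = tt
    DistinctVertices-forward (step _ _ eq p) =
      (λ u∈ → no-back-path eq (prefix p (∈ʷ-forward⁻ p u∈))) , DistinctVertices-forward p

    DistinctEdges-forward : ∀ {u v} (p : u ⇝ v) → DistinctEdges (forward p)
    DistinctEdges-forward (here _) = tt
    DistinctEdges-forward (step e _ _ p) =
      (λ e∈ → acyclic e (prefix p (∈ₑ⇒src-∈ᵥ p (∈ʷₑ-forward⁻ p e∈)))) , DistinctEdges-forward p

    start-∉-tail : ∀ {u v} (p : u ⇝ v) → ¬ InTail u p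
    start-∉-tail (step _ _ eq p) u∈ = no-back-path eq (prefix p u∈)

    end-∉-forward : ∀ {u v} (p : u ⇝ v) → ¬ v ∈ʷ forward p
    end-∉-forward (step _ _ eq p) (inj₁ refl) = no-back-path eq p
    end-∉-forward (step _ _ _ p) (inj₂ v∈) = end-∉-forward p v∈

    DistinctVertices-backward : ∀ {u v} (p : u ⇝ v) → DistinctVertices (backward p)
    DistinctVertices-backward (here _) = tt
    DistinctVertices-backward (step e _ eq p) =
      DistinctVertices-++ (backward p) (cons e (inj₂ (eq , refl)) nil) (DistinctVertices-backward p) ((λ ()) , tt)
        (λ { q q∈ (inj₁ refl) → start-∉-tail p (∈ʷ-backward⁻ p q∈) })

    DistinctEdges-backward : ∀ {u v} (p : u ⇝ v) → DistinctEdges (backward p)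
    DistinctEdges-backward (here _) = tt
    DistinctEdges-backward (step e _ eq p) =
      DistinctEdges-++ (backward p) (cons e (inj₂ (eq , refl)) nil) (DistinctEdges-backward p) ((λ ()) , tt)
        (λ { f f∈ (inj₁ refl) → acyclic e (prefix p (∈ₑ⇒src-∈ᵥ p (∈ʷₑ-backward⁻ p f∈))) })

    length≤nV : ∀ {u v} (p : u ⇝ v) → length p ≤ nV G
    length≤nV p = injective⇒≤ λ {i} {j} → vertexAt-injective (forward p) (DistinctVertices-forward p) i j

    descendant-induction : (Q : Vtx G → Set) → (∀ v → (∀ e → src G e ≡ v → Q (tgt G e)) → Q v) → ∀ v → Q v
    descendant-induction Q ind v = go (suc (nV G)) (here tt) (n<1+n (nV G))
      where
      go : ∀ fuel {u w} (p : u ⇝ w) → nV G < length p + fuel → Q w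
      go zero p bound = ⊥-elim (<⇒≱ (subst (nV G <_) (+-identityʳ _) bound) (length≤nV p))
      go (suc fuel) p bound = ind _ λ e eq → go fuel (snoc p e eq)
        (subst (nV G <_) (trans (+-suc (length p) fuel) (cong (_+ fuel) (sym (length-snoc p e eq)))) bound)

    ancestor-induction : (Q : Vtx G → Set) → (∀ v → (∀ e → tgt G e ≡ v → Q (src G e)) → Q v) → ∀ v → Q v
    ancestor-induction Q ind v = go (suc (nV G)) (here tt) (n<1+n (nV G))
      where
      go : ∀ fuel {v w} (p : v ⇝ w) → nV G < length p + fuel → Q v
      go zero p bound = ⊥-elim (<⇒≱ (subst (nV G <_) (+-identityʳ _) bound) (length≤nV p))
      go (suc fuel) p bound = ind _ λ { e refl →
        go fuel (step e tt refl p) (subst (nV G <_) (+-suc (length p) fuel) bound) }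

    record CycleThrough {z a b k} (P₁ : z ⇝ a) (P₂ : z ⇝ b) (conn : Walk a b k) : Set where
      field
        cycle       : Cycle G
        P₁⊆cycle    : ∀ q → q ∈ᵥ P₁ → OnCycle G q cycle
        P₂⊆cycle    : ∀ q → q ∈ᵥ P₂ → OnCycle G q cycle
        conn⊆cycle  : ∀ f → f ∈ʷₑ conn → EdgeOf G f cycle
        cycle-edges : ∀ f → EdgeOf G f cycle → f ∈ₑ P₁ ⊎ f ∈ʷₑ conn ⊎ f ∈ₑ P₂

    -- The cycle runs forward along P₁, across conn, and back along P₂.
    close-cycle : ∀ {z a b k} (P₁ : z ⇝ a) (P₂ : z ⇝ b) (conn : Walk a b k) →
      DistinctVertices conn → DistinctEdges conn →
      (conn∩P₁ : ∀ q → q ∈ʷ conn → q ∈ᵥ P₁ → q ≡ a) →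
      (P₁∩P₂ : ∀ q → q ∈ᵥ P₁ → q ∈ᵥ P₂ → q ≡ z) →
      (conn∩P₂ : ∀ q → q ∈ʷ conn → q ∈ᵥ P₂ → q ≡ z) →
      (conn-edges : ∀ f → f ∈ʷₑ conn → f ∈ₑ P₁ ⊎ f ∈ₑ P₂ → ⊥) →
      a ∈ʷ conn → 2 ≤ length P₁ + (k + backLength P₂) →
      CycleThrough P₁ P₂ conn
    close-cycle {z} {a} P₁ P₂ conn dv de conn∩P₁ P₁∩P₂ conn∩P₂ conn-edges a∈conn 2≤len = record
      { cycle = cycle ; P₁⊆cycle = P₁⊆cycle ; P₂⊆cycle = P₂⊆cycle
      ; conn⊆cycle = conn⊆cycle ; cycle-edges = cycle-edges }
      where
      back = conn ++ʷ backward P₂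
      loop = forward P₁ ++ʷ back

      z-only-in-tail : ∀ q → InTail q P₂ → q ≡ z → ⊥
      z-only-in-tail q q∈ refl = start-∉-tail P₂ q∈

      dv-back : DistinctVertices back
      dv-back = DistinctVertices-++ conn (backward P₂) dv (DistinctVertices-backward P₂) λ q q∈c q∈b →
        let q∈tail = ∈ʷ-backward⁻ P₂ q∈b in
        z-only-in-tail q q∈tail (conn∩P₂ q q∈c (InTail⇒∈ᵥ P₂ q∈tail))

      dv-loop : DistinctVertices loop
      dv-loop = DistinctVertices-++ (forward P₁) back (DistinctVertices-forward P₁) dv-back λ q q∈f q∈b →
        [ (λ q∈c → end-∉-forward P₁ (subst (_∈ʷ forward P₁) (conn∩P₁ q q∈c (∈ʷ-forward⁻ P₁ q∈f)) q∈f))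
        , (λ q∈bw → let q∈tail = ∈ʷ-backward⁻ P₂ q∈bw in
             z-only-in-tail q q∈tail (P₁∩P₂ q (∈ʷ-forward⁻ P₁ q∈f) (InTail⇒∈ᵥ P₂ q∈tail))) ]′
        (∈ʷ-++⁻ conn (backward P₂) q∈b)

      de-back : DistinctEdges back
      de-back = DistinctEdges-++ conn (backward P₂) de (DistinctEdges-backward P₂)
        λ f f∈c f∈b → conn-edges f f∈c (inj₂ (∈ʷₑ-backward⁻ P₂ f∈b))

      -- an edge on both P₁ and P₂ would have its target, and hence its source, equal to z
      de-loop : DistinctEdges loop
      de-loop = DistinctEdges-++ (forward P₁) back (DistinctEdges-forward P₁) de-back λ f f∈f f∈b →
        let f∈P₁ = ∈ʷₑ-forward⁻ P₁ f∈f in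
        [ (λ f∈c → conn-edges f f∈c (inj₁ f∈P₁))
        , (λ f∈bw → let f∈P₂ = ∈ʷₑ-backward⁻ P₂ f∈bw
                        tgt≡z = P₁∩P₂ (tgt G f) (∈ₑ⇒tgt-∈ᵥ P₁ f∈P₁) (∈ₑ⇒tgt-∈ᵥ P₂ f∈P₂) in
             acyclic f (subst (_⇝ src G f) (sym tgt≡z) (prefix P₁ (∈ₑ⇒src-∈ᵥ P₁ f∈P₁)))) ]′
        (∈ʷₑ-++⁻ conn (backward P₂) f∈b)

      cycle : Cycle G
      cycle = walk⇒cycle loop 2≤len dv-loop de-loop

      on-loop : ∀ q → q ∈ʷ loop → OnCycle G q cycle
      on-loop q q∈ with ∈ʷ⇒vertexAt loop q∈
      ... | i , eq = inject₁ i , eq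

      P₁⊆cycle : ∀ q → q ∈ᵥ P₁ → OnCycle G q cycle
      P₁⊆cycle q q∈ with ∈ʷ-forward⁺ P₁ q∈
      ... | inj₁ q∈f = on-loop q (∈ʷ-++ˡ (forward P₁) back q∈f)
      ... | inj₂ refl = on-loop q (∈ʷ-++ʳ (forward P₁) back (∈ʷ-++ˡ conn (backward P₂) a∈conn))

      P₂⊆cycle : ∀ q → q ∈ᵥ P₂ → OnCycle G q cycle
      P₂⊆cycle q q∈ with ∈ᵥ⇒start⊎InTail P₂ q∈
      ... | inj₁ refl = zero , vertexAt-start loop
      ... | inj₂ q∈tail =
        on-loop q (∈ʷ-++ʳ (forward P₁) back (∈ʷ-++ʳ conn (backward P₂) (∈ʷ-backward⁺ P₂ q∈tail)))

      conn⊆cycle : ∀ f → f ∈ʷₑ conn → EdgeOf G f cycle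
      conn⊆cycle f f∈ = ∈ʷₑ⇒edgeAt loop (∈ʷₑ-++ʳ (forward P₁) back (∈ʷₑ-++ˡ conn (backward P₂) f∈))

      cycle-edges : ∀ f → EdgeOf G f cycle → f ∈ₑ P₁ ⊎ f ∈ʷₑ conn ⊎ f ∈ₑ P₂
      cycle-edges f (i , refl) with ∈ʷₑ-++⁻ (forward P₁) back (edgeAt-∈ʷₑ loop i)
      ... | inj₁ f∈f = inj₁ (∈ʷₑ-forward⁻ P₁ f∈f)
      ... | inj₂ f∈b with ∈ʷₑ-++⁻ conn (backward P₂) f∈b
      ...   | inj₁ f∈c = inj₂ (inj₁ f∈c)
      ...   | inj₂ f∈bw = inj₂ (inj₂ (∈ʷₑ-backward⁻ P₂ f∈bw))

    root-reaches : ∀ r → (∀ v → IsRoot G v → v ≡ r) → ∀ v → ¬ ¬ (r ⇝ v)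
    root-reaches r root-unique = ancestor-induction (λ v → ¬ ¬ (r ⇝ v)) λ v ih → do
      yes (e , eq) ← ¬¬-excluded-middle {A = ∃ λ e → tgt G e ≡ v}
        where no no-parent → return (subst (r ⇝_) (sym (root-unique v λ e eq → no-parent (e , eq))) (here tt))
      p ← ih e eq
      return (subst (r ⇝_) eq (snoc p e refl))

    reaches-sink : ∀ v → ¬ ¬ (∃ λ s → v ⇝ s × OutDeg0 G s)
    reaches-sink = descendant-induction (λ v → ¬ ¬ (∃ λ s → v ⇝ s × OutDeg0 G s)) λ v ih → do
      yes (e , eq) ← ¬¬-excluded-middle {A = ∃ λ e → src G e ≡ v}
        where no no-child → return (v , here tt , λ e eq → no-child (e , eq))
      (s , p , sink) ← ih e eq
      return (s , step e tt eq p , sink)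

    reach? : (∀ (Q : E G → Set) → (∀ e → Dec (Q e)) → Dec (∃ Q)) → ∀ v w → Dec (v ⇝ w)
    reach? search = descendant-induction (λ v → ∀ w → Dec (v ⇝ w)) λ v ih w → reach-from ih w (v ≟ w)
      where
      reach-from : ∀ {v} → (∀ e → src G e ≡ v → ∀ w → Dec (tgt G e ⇝ w)) → ∀ w → Dec (v ≡ w) → Dec (v ⇝ w)
      reach-from ih w (yes refl) = yes (here tt)
      reach-from {v} ih w (no v≢w) =
        map′ (λ (e , eq , p) → step e tt eq p) (λ { (here _) → ⊥-elim (v≢w refl) ; (step e _ eq p) → e , eq , p })
             (search (λ e → src G e ≡ v × tgt G e ⇝ w) child?)
        where
        child? : ∀ e → Dec (src G e ≡ v × tgt G e ⇝ w)
        child? e with src G e ≟ v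
        ... | yes eq = map′ (eq ,_) proj₂ (ih e eq w)
        ... | no ne = no (ne ∘ proj₁)

    -- Two distinct edges into one node close a cycle with the fork of paths from the root to their sources.
    in-degree≤1 : ∀ r → (∀ v → IsRoot G v → v ≡ r) → (Cycle G → ⊥) →
                  ∀ e₁ e₂ → tgt G e₁ ≡ tgt G e₂ → ¬ ¬ (e₁ ≡ e₂)
    in-degree≤1 r root-unique no-cycle e₁ e₂ same-tgt = do
      no e₁≢e₂ ← ¬¬-excluded-middle {A = e₁ ≡ e₂}
        where yes e₁≡e₂ → return e₁≡e₂
      P₁ ← root-reaches r root-unique (src G e₁)
      P₂ ← root-reaches r root-unique (src G e₂)
      fork Q₁ Q₂ disjoint ← ¬¬-fork P₁ P₂
      ⊥-elim (no-cycle (CycleThrough.cycle (through e₁≢e₂ Q₁ Q₂ disjoint)))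
      where
      v = tgt G e₁
      conn : Walk (src G e₁) (src G e₂) 2
      conn = cons e₁ (inj₁ (refl , refl)) (cons e₂ (inj₂ (refl , sym same-tgt)) nil)
      v∉₁ : ∀ {z} (P : z ⇝ src G e₁) → ¬ v ∈ᵥ P
      v∉₁ P v∈ = acyclic e₁ (proj₁ (suffix P v∈))
      v∉₂ : ∀ {z} (P : z ⇝ src G e₂) → ¬ v ∈ᵥ P
      v∉₂ P v∈ = acyclic e₂ (subst (_⇝ src G e₂) same-tgt (proj₁ (suffix P v∈)))
      through : e₁ ≢ e₂ → ∀ {z} (P₁ : z ⇝ src G e₁) (P₂ : z ⇝ src G e₂) →
                (∀ q → q ∈ᵥ P₁ → q ∈ᵥ P₂ → q ≡ z) → CycleThrough P₁ P₂ conn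
      through e₁≢e₂ P₁ P₂ disjoint = close-cycle P₁ P₂ conn
        ((λ { (inj₁ eq) → acyclic e₁ (subst (v ⇝_) (sym eq) (here tt)) }) , (λ ()) , tt)
        ((λ { (inj₁ eq) → e₁≢e₂ eq }) , (λ ()) , tt)
        (λ { q (inj₁ refl) _ → refl ; q (inj₂ (inj₁ refl)) v∈ → ⊥-elim (v∉₁ P₁ v∈) })
        disjoint
        (λ { q (inj₁ refl) q∈ → disjoint q (end-∈ᵥ P₁) q∈ ; q (inj₂ (inj₁ refl)) v∈ → ⊥-elim (v∉₂ P₂ v∈) })
        (λ { f (inj₁ refl) (inj₁ f∈) → v∉₁ P₁ (∈ₑ⇒tgt-∈ᵥ P₁ f∈)
           ; f (inj₁ refl) (inj₂ f∈) → v∉₂ P₂ (∈ₑ⇒tgt-∈ᵥ P₂ f∈)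
           ; f (inj₂ (inj₁ refl)) (inj₁ f∈) → v∉₁ P₁ (subst (_∈ᵥ P₁) (sym same-tgt) (∈ₑ⇒tgt-∈ᵥ P₁ f∈))
           ; f (inj₂ (inj₁ refl)) (inj₂ f∈) → v∉₂ P₂ (subst (_∈ᵥ P₂) (sym same-tgt) (∈ₑ⇒tgt-∈ᵥ P₂ f∈)) })
        (inj₁ refl)
        (≤-trans (s≤s (s≤s z≤n)) (m≤n+m _ (length P₁)))

-- Networks with a support tree and a base tree

support-or-transfer : ∀ {m} (isS : Fin m → Bool) e → T (isS e) ⊎ isS e ≡ false
support-or-transfer isS e with isS e
... | true = inj₁ tt
... | false = inj₂ refl

transfer⇒¬support : ∀ {b} → b ≡ false → ¬ T b
transfer⇒¬support refl ()

module Network {n : ℕ} (Tr : LNet n) (T-tree : IsTree (graph Tr)) (T-leaves : HasLeafSet (graph Tr) (leaf Tr))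
  (N : LNet n) (isS : Fin (nEdge N) → Bool) (lgt : IsLGT N isS) (galled : IsGalledTree (graph N))
  (N-leaves : HasLeafSet (graph N) (leaf N)) (base : HasBaseTree N isS Tr) where

  Nb : Graph
  Nb = supportGraph N isS

  open Paths Nb
  open Acyclicity (proj₁ (proj₁ (proj₁ (proj₂ lgt))))
  module NetPaths = Paths (graph N)
  module NetAcyclicity = NetPaths.Acyclicity (proj₁ (proj₁ lgt))
  open Paths (graph Tr) using () renaming (_⇝_ to _⇝ᵀ_; _++_ to _++ᵀ_)
  module TreeAcyclicity = Paths.Acyclicity (graph Tr) (proj₁ (proj₁ T-tree))

  rootT : Fin (nVert Tr)
  rootT = proj₁ (proj₂ (proj₁ T-tree))

  rootT-unique : ∀ v → IsRoot (graph Tr) v → v ≡ rootT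
  rootT-unique = proj₂ (proj₂ (proj₂ (proj₁ T-tree)))

  rootS : Fin (nVert N)
  rootS = proj₁ (proj₂ (proj₁ (proj₁ (proj₂ lgt))))

  support-root-reaches : ∀ v → ¬ ¬ (rootS ⇝ v)
  support-root-reaches = root-reaches rootS (proj₂ (proj₂ (proj₂ (proj₁ (proj₁ (proj₂ lgt))))))

  support-in-degree≤1 : ∀ ε₁ ε₂ → tgt Nb ε₁ ≡ tgt Nb ε₂ → ¬ ¬ (ε₁ ≡ ε₂)
  support-in-degree≤1 = in-degree≤1 rootS (proj₂ (proj₂ (proj₂ (proj₁ (proj₁ (proj₂ lgt))))))
                                          (proj₂ (proj₁ (proj₂ lgt)))

  Endpoint : Fin (nEdge N) → Fin (nVert N) → Set
  Endpoint e q = q ≡ s N e ⊎ q ≡ t N e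

  transfer-not-below : ∀ e → isS e ≡ false → ¬ (s N e ⇝ t N e)
  transfer-not-below e transfer = proj₁ (proj₁ (proj₂ (proj₂ lgt) e transfer))

  transfer-endpoint-has-child : ∀ e → isS e ≡ false → ∀ q → Endpoint e q → ∃ λ ε → src Nb ε ≡ q
  transfer-endpoint-has-child e transfer q (inj₁ refl) =
    let (ε , eq , _) = proj₁ (proj₂ (proj₂ (proj₂ lgt) e transfer)) in ε , eq
  transfer-endpoint-has-child e transfer q (inj₂ refl) =
    let (ε , eq , _) = proj₂ (proj₂ (proj₂ (proj₂ lgt) e transfer)) in ε , eq

  distinct-cycles-disjoint : ∀ c₁ c₂ → ¬ SameEdges (graph N) c₁ c₂ → ∀ v →
                         OnCycle (graph N) v c₁ → OnCycle (graph N) v c₂ → ⊥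
  distinct-cycles-disjoint c₁ c₂ different v v∈c₁ v∈c₂ = proj₂ galled c₁ c₂ (different , v , v∈c₁ , v∈c₂)

  φ : Fin (nVert Tr) → Fin (nVert N)
  φ = proj₁ base

  φ-injective : ∀ u v → φ u ≡ φ v → u ≡ v
  φ-injective = proj₁ (proj₂ base)

  φ-not-subdivision : ∀ v → ¬ IsSubdiv Nb (φ v)
  φ-not-subdivision = proj₁ (proj₂ (proj₂ base))

  φ-onto : ∀ w → ¬ IsSubdiv Nb w → ∃ λ v → φ v ≡ w
  φ-onto = proj₁ (proj₂ (proj₂ (proj₂ base)))

  φ-edge⁺ : ∀ u v → (∃ λ e → s Tr e ≡ u × t Tr e ≡ v) → SPath Nb (φ u) (φ v)
  φ-edge⁺ u v = proj₁ (proj₁ (proj₂ (proj₂ (proj₂ (proj₂ base)))) u v)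

  φ-edge⁻ : ∀ u v → SPath Nb (φ u) (φ v) → ∃ λ e → s Tr e ≡ u × t Tr e ≡ v
  φ-edge⁻ u v = proj₂ (proj₁ (proj₂ (proj₂ (proj₂ (proj₂ base)))) u v)

  φ-leaf : ∀ x → φ (leaf Tr x) ≡ leaf N x
  φ-leaf = proj₂ (proj₂ (proj₂ (proj₂ (proj₂ base))))

  support⇒net : ∀ {u v} → u ⇝ v → NetPaths._⇝_ u v
  support⇒net (here _) = here tt
  support⇒net (step ε _ eq p) = step (proj₁ ε) tt eq (support⇒net p)

  ∈ᵥ-support⇒net⁺ : ∀ {u v q} (p : u ⇝ v) → q ∈ᵥ p → NetPaths._∈ᵥ_ q (support⇒net p)
  ∈ᵥ-support⇒net⁺ (here _) q∈ = q∈
  ∈ᵥ-support⇒net⁺ (step _ _ _ _) (inj₁ eq) = inj₁ eq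
  ∈ᵥ-support⇒net⁺ (step _ _ _ p) (inj₂ q∈) = inj₂ (∈ᵥ-support⇒net⁺ p q∈)

  ∈ᵥ-support⇒net⁻ : ∀ {u v q} (p : u ⇝ v) → NetPaths._∈ᵥ_ q (support⇒net p) → q ∈ᵥ p
  ∈ᵥ-support⇒net⁻ (here _) q∈ = q∈
  ∈ᵥ-support⇒net⁻ (step _ _ _ _) (inj₁ eq) = inj₁ eq
  ∈ᵥ-support⇒net⁻ (step _ _ _ p) (inj₂ q∈) = inj₂ (∈ᵥ-support⇒net⁻ p q∈)

  ∈ₑ-support⇒net : ∀ {u v f} (p : u ⇝ v) → NetPaths._∈ₑ_ f (support⇒net p) → T (isS f)
  ∈ₑ-support⇒net (step ε _ _ _) (inj₁ refl) = proj₂ ε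
  ∈ₑ-support⇒net (step _ _ _ p) (inj₂ f∈) = ∈ₑ-support⇒net p f∈

  record TransferCycle (e : Fin (nEdge N)) : Set where
    field
      cycle             : Cycle (graph N)
      e∈cycle           : EdgeOf (graph N) e cycle
      other-edges       : ∀ f → EdgeOf (graph N) f cycle → f ≡ e ⊎ T (isS f)
      apex              : Fin (nVert N)
      path-to-endpoint  : ∀ q → Endpoint e q → Σ (apex ⇝ q) λ P → ∀ v → v ∈ᵥ P → OnCycle (graph N) v cycle

  -- The support paths from the lowest common ancestor of the endpoints, closed by the transfer edge.
  transfer-cycle : ∀ e → isS e ≡ false → ¬ ¬ TransferCycle e
  transfer-cycle e transfer = do
    P₁ ← support-root-reaches (s N e)
    P₂ ← support-root-reaches (t N e)
    fork Q₁ Q₂ disjoint ← ¬¬-fork P₁ P₂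
    close Q₁ Q₂ disjoint
    where
    not-below = transfer-not-below e transfer
    conn : NetPaths.Walk (s N e) (t N e) 1
    conn = NetPaths.cons e (inj₁ (refl , refl)) NetPaths.nil
    close : ∀ {z} (P₁ : z ⇝ s N e) (P₂ : z ⇝ t N e) → (∀ q → q ∈ᵥ P₁ → q ∈ᵥ P₂ → q ≡ z) →
            ¬ ¬ TransferCycle e
    close (here _) P₂ _ = ⊥-elim (not-below P₂)
    close {z} P₁@(step _ _ _ P₁′) P₂ disjoint = return record
      { cycle = Closed.cycle
      ; e∈cycle = Closed.conn⊆cycle e (inj₁ refl)
      ; other-edges = λ f f∈ → [ inj₂ ∘ ∈ₑ-support⇒net P₁
                               , [ (λ { (inj₁ f≡e) → inj₁ f≡e }) , inj₂ ∘ ∈ₑ-support⇒net P₂ ]′ ]′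
                               (Closed.cycle-edges f f∈)
      ; apex = z
      ; path-to-endpoint = λ
          { q (inj₁ refl) → P₁ , λ v v∈ → Closed.P₁⊆cycle v (∈ᵥ-support⇒net⁺ P₁ v∈)
          ; q (inj₂ refl) → P₂ , λ v v∈ → Closed.P₂⊆cycle v (∈ᵥ-support⇒net⁺ P₂ v∈) } }
      where
      closed : NetAcyclicity.CycleThrough (support⇒net P₁) (support⇒net P₂) conn
      closed = NetAcyclicity.close-cycle (support⇒net P₁) (support⇒net P₂) conn ((λ ()) , tt) ((λ ()) , tt)
        (λ { q (inj₁ q≡a) _ → q≡a })
        (λ q q∈₁ q∈₂ → disjoint q (∈ᵥ-support⇒net⁻ P₁ q∈₁) (∈ᵥ-support⇒net⁻ P₂ q∈₂))
        (λ { q (inj₁ refl) q∈ → ⊥-elim (not-below (proj₁ (suffix P₂ (∈ᵥ-support⇒net⁻ P₂ q∈)))) })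
        (λ { f (inj₁ refl) (inj₁ f∈) → transfer⇒¬support transfer (∈ₑ-support⇒net P₁ f∈)
           ; f (inj₁ refl) (inj₂ f∈) → transfer⇒¬support transfer (∈ₑ-support⇒net P₂ f∈) })
        (inj₁ refl)
        (s≤s (≤-trans (s≤s z≤n) (m≤n+m _ _)))
      module Closed = NetAcyclicity.CycleThrough closed

  -- A sink of the support tree with a parent there is a leaf of N: transfer edges
  -- attach only to nodes with a child in the support tree.
  support-sink-is-leaf : ∀ {v} → OutDeg0 Nb v → (ε : E Nb) → tgt Nb ε ≡ v → IsLeaf (graph N) v
  support-sink-is-leaf {v} sink ε ε↦v =
    (proj₁ ε , ε↦v , λ e e↦v → only-parent e e↦v (support-or-transfer isS e)) ,
    λ e v↦e → no-child e v↦e (support-or-transfer isS e)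
    where
    only-parent : ∀ e → t N e ≡ v → T (isS e) ⊎ isS e ≡ false → e ≡ proj₁ ε
    only-parent e e↦v (inj₁ support) =
      decidable-stable (e ≟ proj₁ ε) λ e≢ε →
        support-in-degree≤1 (e , support) ε (trans e↦v (sym ε↦v)) (e≢ε ∘ cong proj₁)
    only-parent e e↦v (inj₂ transfer) =
      let (ε′ , ε′-src) = transfer-endpoint-has-child e transfer (t N e) (inj₂ refl) in
      ⊥-elim (sink ε′ (trans ε′-src e↦v))
    no-child : ∀ e → s N e ≡ v → T (isS e) ⊎ isS e ≡ false → ⊥
    no-child e v↦e (inj₁ support) = sink (e , support) v↦e
    no-child e v↦e (inj₂ transfer) =
      let (ε′ , ε′-src) = transfer-endpoint-has-child e transfer (s N e) (inj₁ refl) in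
      sink ε′ (trans ε′-src v↦e)

  reaches-leaf : ∀ q → (∃ λ ε → src Nb ε ≡ q) → ¬ ¬ (∃ λ x → q ⇝ leaf N x)
  reaches-leaf q (ε₀ , ε₀-src) = do
    (v , p , sink) ← reaches-sink q
    inj₂ (ε , _ , ε↦v) ← return (last-edge p)
      where inj₁ refl → ⊥-elim (sink ε₀ ε₀-src)
    let (x , x↦v) = proj₂ (proj₂ N-leaves) v (support-sink-is-leaf sink ε ε↦v)
    return (x , subst (q ⇝_) (sym x↦v) p)

  φ-reach : ∀ {u v} → u ⇝ᵀ v → φ u ⇝ φ v
  φ-reach (here _) = here tt
  φ-reach {u} (step e _ eq p) = SPath⇒⇝ (φ-edge⁺ u (t Tr e) (e , eq , refl)) ++ φ-reach p

  φ-reach-leaf : ∀ {u x} → u ⇝ᵀ leaf Tr x → φ u ⇝ leaf N x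
  φ-reach-leaf {u} {x} p = subst (φ u ⇝_) (φ-leaf x) (φ-reach p)

  -- Invariant: q is φ v, or hangs below φ v on a chain of subdivision nodes.
  φ-reach⁻-from : ∀ {v q w} → q ⇝ φ w → q ≡ φ v ⊎ (SPath Nb (φ v) q × IsSubdiv Nb q) → ¬ ¬ (v ⇝ᵀ w)
  φ-reach⁻-from {v} {w = w} (here _) (inj₁ w≡v) = return (subst (v ⇝ᵀ_) (sym (φ-injective w v w≡v)) (here tt))
  φ-reach⁻-from {w = w} (here _) (inj₂ (_ , sub)) = ⊥-elim (φ-not-subdivision w sub)
  φ-reach⁻-from {v} {q} {w} (step ε _ eq p) chain = do
    no ¬sub ← ¬¬-excluded-middle {A = IsSubdiv Nb (tgt Nb ε)}
      where yes sub → φ-reach⁻-from p (inj₂ (chain′ , sub))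
    let (u , φu≡) = φ-onto (tgt Nb ε) ¬sub
        (e , e-src , e-tgt) = φ-edge⁻ v u (subst (SPath Nb (φ v)) (sym φu≡) chain′)
    u⇝w ← φ-reach⁻-from p (inj₁ (sym φu≡))
    return (step e tt e-src (subst (_⇝ᵀ w) (sym e-tgt) u⇝w))
    where
    chain′ : SPath Nb (φ v) (tgt Nb ε)
    chain′ = [ (λ q≡φv → one ε (trans eq q≡φv) refl) , (λ (sp , sub) → SPath-snoc sp sub ε eq) ]′ chain

  φ-reach⁻ : ∀ {v w} → φ v ⇝ φ w → ¬ ¬ (v ⇝ᵀ w)
  φ-reach⁻ p = φ-reach⁻-from p (inj₁ refl)

  leaf-not-subdivision : ∀ x → ¬ IsSubdiv Nb (leaf N x)
  leaf-not-subdivision x (_ , ε , ε-src , _) = proj₂ (proj₁ (proj₂ N-leaves) x) (proj₁ ε) ε-src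

  -- The first support edge on the image of the edge p → c of T.
  record ImageEdge (p c : Fin (nVert Tr)) : Set where
    field
      first     : E Nb
      first-src : src Nb first ≡ φ p
      first-tgt : tgt Nb first ≡ φ c ⊎ (SPath Nb (tgt Nb first) (φ c) × IsSubdiv Nb (tgt Nb first))

  image-edge : ∀ {p c} → (∃ λ e → s Tr e ≡ p × t Tr e ≡ c) → ImageEdge p c
  image-edge {p} {c} e with φ-edge⁺ p c e
  ... | one ε ε-src ε-tgt = record { first = ε ; first-src = ε-src ; first-tgt = inj₁ ε-tgt }
  ... | more ε ε-src sub rest = record { first = ε ; first-src = ε-src ; first-tgt = inj₂ (rest , sub) }

  Explained : Subset n → Set
  Explained X = ∃ λ w → ¬ F N isS X w × (∀ x → x ∈ X → PathIn (graph N) (λ v → ¬ F N isS X v) w (leaf N x))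

  -- The part of the support tree below the image of a tree edge p → c.
  module Region {p c} (σ : ImageEdge p c) where
    open ImageEdge σ

    Inside : Fin (nVert N) → Set
    Inside q = tgt Nb first ⇝ q

    φc-inside : Inside (φ c)
    φc-inside = [ (λ eq → subst Inside eq (here tt)) , (λ (sp , _) → SPath⇒⇝ sp) ]′ first-tgt

    below-c⇒inside : ∀ {x} → c ⇝ᵀ leaf Tr x → Inside (leaf N x)
    below-c⇒inside p = φc-inside ++ φ-reach-leaf p

    inside⇒below-c : ∀ {x} → Inside (leaf N x) → ¬ ¬ (c ⇝ᵀ leaf Tr x)
    inside⇒below-c {x} x-in = φ-reach⁻ (subst (φ c ⇝_) (sym (φ-leaf x)) from-φc)
      where
      from-φc : φ c ⇝ leaf N x
      from-φc = [ (λ eq → subst (_⇝ leaf N x) eq x-in)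
                , (λ (sp , sub) → SPath-forced sp sub x-in (leaf-not-subdivision x)) ]′ first-tgt

    enter-from-φp : (ε : E Nb) → Inside (tgt Nb ε) → ¬ Inside (src Nb ε) → ¬ ¬ (src Nb ε ≡ φ p)
    enter-from-φp ε tgt-in src-out with last-edge tgt-in
    ... | inj₁ first↦ = do
      ε≡first ← support-in-degree≤1 ε first (sym first↦)
      return (trans (cong (src Nb) ε≡first) first-src)
    ... | inj₂ (ε′ , src-in , ε′↦) = do
      ε≡ε′ ← support-in-degree≤1 ε ε′ (sym ε′↦)
      ⊥-elim (src-out (subst (λ ε″ → Inside (src Nb ε″)) (sym ε≡ε′) src-in))

    enter-through-φp : ∀ {u v} (P : u ⇝ v) → ¬ Inside u → Inside v → ¬ ¬ (φ p ∈ᵥ P)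
    enter-through-φp (here _) u-out v-in = ⊥-elim (u-out v-in)
    enter-through-φp (step ε _ eq P) u-out v-in = do
      yes next-in ← ¬¬-excluded-middle {A = Inside (tgt Nb ε)}
        where no next-out → inj₂ <$> enter-through-φp P next-out v-in
      src≡φp ← enter-from-φp ε next-in (u-out ∘ subst Inside eq)
      return (inj₁ (trans (sym src≡φp) eq))

    reaches-φp : ∀ {u v} (P : u ⇝ v) → ¬ Inside u → Inside v → ¬ ¬ (u ⇝ φ p)
    reaches-φp P u-out v-in = prefix P <$> enter-through-φp P u-out v-in

    record CrossingTransfer (X : Subset n) : Set where
      field
        edge           : Fin (nEdge N)
        transfer       : isS edge ≡ false
        inner outer    : Fin (nVert N)
        inner-endpoint : Endpoint edge inner
        outer-endpoint : Endpoint edge outer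
        endpoints-∉F   : ∀ q → Endpoint edge q → ¬ F N isS X q
        inner-inside   : Inside inner
        outer-outside  : ¬ Inside outer

    -- A path of X-admissible nodes that crosses the region boundary does so by a transfer edge:
    -- support edges cannot leave the region, and enter it only from φ p ∈ F_X.
    crossing-transfer : ∀ X → Explained X → F N isS X (φ p) →
      ∀ a → a ∈ X → Inside (leaf N a) → ∀ b → b ∈ X → ¬ Inside (leaf N b) → ¬ ¬ CrossingTransfer X
    crossing-transfer X (w , _ , paths) φp∈F a a∈X a-in b b∈X b-out = do
      no w-out ← ¬¬-excluded-middle {A = Inside w}
        where yes w-in → do
                (e , s∉F , t∉F , s-in , t-out) ← NetPaths.exit-edge (paths b b∈X) w-in b-out
                exiting e s∉F t∉F s-in t-out (support-or-transfer isS e)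
      (e , s∉F , t∉F , s-out , t-in) ← NetPaths.entry-edge (paths a a∈X) w-out a-in
      entering e s∉F t∉F s-out t-in (support-or-transfer isS e)
      where
      endpoints : ∀ e → ¬ F N isS X (s N e) → ¬ F N isS X (t N e) → ∀ q → Endpoint e q → ¬ F N isS X q
      endpoints e s∉F t∉F q (inj₁ refl) = s∉F
      endpoints e s∉F t∉F q (inj₂ refl) = t∉F
      exiting : ∀ e → ¬ F N isS X (s N e) → ¬ F N isS X (t N e) → Inside (s N e) → ¬ Inside (t N e) →
                T (isS e) ⊎ isS e ≡ false → ¬ ¬ CrossingTransfer X
      exiting e _ _ s-in t-out (inj₁ support) = ⊥-elim (t-out (s-in ++ edge-path (e , support)))
      exiting e s∉F t∉F s-in t-out (inj₂ transfer) = return record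
        { edge = e ; transfer = transfer ; inner = s N e ; outer = t N e
        ; inner-endpoint = inj₁ refl ; outer-endpoint = inj₂ refl ; endpoints-∉F = endpoints e s∉F t∉F
        ; inner-inside = s-in ; outer-outside = t-out }
      entering : ∀ e → ¬ F N isS X (s N e) → ¬ F N isS X (t N e) → ¬ Inside (s N e) → Inside (t N e) →
                 T (isS e) ⊎ isS e ≡ false → ¬ ¬ CrossingTransfer X
      entering e s∉F _ s-out t-in (inj₁ support) = do
        src≡φp ← enter-from-φp (e , support) t-in s-out
        ⊥-elim (s∉F (subst (F N isS X) (sym src≡φp) φp∈F))
      entering e s∉F t∉F s-out t-in (inj₂ transfer) = return record
        { edge = e ; transfer = transfer ; inner = t N e ; outer = s N e
        ; inner-endpoint = inj₂ refl ; outer-endpoint = inj₁ refl ; endpoints-∉F = endpoints e s∉F t∉F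
        ; inner-inside = t-in ; outer-outside = s-out }

    -- From outside, the path would have to pass φ p ∈ F_X.
    reaches-inside⇒inside : ∀ {X q x} → F N isS X (φ p) → ¬ F N isS X q → q ⇝ leaf N x → Inside (leaf N x) →
                            ¬ ¬ Inside q
    reaches-inside⇒inside {q = q} (z , z∉X , φp⇝z) q∉F q⇝x x-in = do
      no q-out ← ¬¬-excluded-middle {A = Inside q}
        where yes q-in → return q-in
      q⇝φp ← reaches-φp q⇝x q-out x-in
      ⊥-elim (q∉F (z , z∉X , q⇝φp ++ φp⇝z))

    outer-∉F : ∀ {X C} → F N isS X (φ p) → (cr : CrossingTransfer X) →
               (∀ x → x ∈ X → x ∉ C → Inside (leaf N x)) → ¬ F N isS C (CrossingTransfer.outer cr)
    outer-∉F {X} φp∈F cr X∖C-inside (x , x∉C , outer⇝x) with x ∈? X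
    ... | no x∉X = endpoints-∉F outer outer-endpoint (x , x∉X , outer⇝x)
      where open CrossingTransfer cr
    ... | yes x∈X = reaches-inside⇒inside φp∈F (endpoints-∉F outer outer-endpoint) outer⇝x
                      (X∖C-inside x x∈X x∉C) outer-outside
      where open CrossingTransfer cr

    φp-on-transfer-cycle : ∀ {e} (tc : TransferCycle e) → ¬ Inside (TransferCycle.apex tc) →
                           ∀ q → Endpoint e q → Inside q → ¬ ¬ OnCycle (graph N) (φ p) (TransferCycle.cycle tc)
    φp-on-transfer-cycle tc apex-out q q-end q-in =
      let (P , P⊆cycle) = TransferCycle.path-to-endpoint tc q q-end in
      P⊆cycle (φ p) <$> enter-through-φp P apex-out q-in

  -- Characters and first-appearance nodes

  leaf-LSub : ∀ {C} x → x ∈ C → LSub Tr (leaf Tr x) C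
  leaf-LSub {C} x x∈C y = from-leaf refl
    where
    from-leaf : ∀ {u} → u ≡ leaf Tr x → u ⇝ᵀ leaf Tr y → y ∈ C
    from-leaf y↦x (here _) = subst (_∈ C) (sym (proj₁ T-leaves y x y↦x)) x∈C
    from-leaf u↦x (step e _ e↦u _) = ⊥-elim (proj₂ (proj₁ (proj₂ T-leaves) x) e (trans e↦u u↦x))

  ¬LSub⇒F : ∀ {p} X → ¬ LSub Tr p X → ¬ ¬ F N isS X (φ p)
  ¬LSub⇒F {p} X p⊈X = do
    yes (x , p⇝x , x∉X) ← ¬¬-excluded-middle {A = ∃ λ x → p ⇝ᵀ leaf Tr x × x ∉ X}
      where no none → ⊥-elim (p⊈X λ x p⇝x → decidable-stable (x ∈? X) λ x∉X → none (x , p⇝x , x∉X))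
    return (x , x∉X , φ-reach-leaf p⇝x)

  T-reach? : ∀ u v → Dec (u ⇝ᵀ v)
  T-reach? = TreeAcyclicity.reach? λ _ Q? → any? Q?

  IsClade? : ∀ C → Dec (IsClade Tr C)
  IsClade? C = any? λ v → all? λ x →
    ((x ∈? C) →-dec T-reach? v (leaf Tr x)) ×-dec (T-reach? v (leaf Tr x) →-dec (x ∈? C))

  record FirstAppearance (C : Subset n) (b : Fin n) : Set where
    field
      node parent : Fin (nVert Tr)
      parent→node : ∃ λ e → s Tr e ≡ parent × t Tr e ≡ node
      node⊆C      : LSub Tr node C
      node⇝b      : node ⇝ᵀ leaf Tr b
      parent⊈C    : ¬ LSub Tr parent C

  -- Climb from b while the leaves below stay in C; the root is never reached since a ∉ C.
  first-appearance : ∀ C {a} → a ∉ C → ∀ b → b ∈ C → ¬ ¬ FirstAppearance C b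
  first-appearance C {a} a∉C b b∈C = climb (leaf Tr b) (leaf-LSub b b∈C) (here tt)
    where
    climb : ∀ v → LSub Tr v C → v ⇝ᵀ leaf Tr b → ¬ ¬ FirstAppearance C b
    climb = TreeAcyclicity.ancestor-induction (λ v → LSub Tr v C → v ⇝ᵀ leaf Tr b → ¬ ¬ FirstAppearance C b)
      λ v ih v⊆C v⇝b → do
        yes (e , e↦v) ← ¬¬-excluded-middle {A = ∃ λ e → t Tr e ≡ v}
          where no no-parent → do
                  root⇝a ← TreeAcyclicity.root-reaches rootT rootT-unique (leaf Tr a)
                  let v≡root = rootT-unique v λ e e↦v → no-parent (e , e↦v)
                  ⊥-elim (a∉C (v⊆C a (subst (_⇝ᵀ leaf Tr a) (sym v≡root) root⇝a)))
        no parent⊈C ← ¬¬-excluded-middle {A = LSub Tr (s Tr e) C}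
          where yes parent⊆C → ih e e↦v parent⊆C (step e tt refl (subst (_⇝ᵀ leaf Tr b) (sym e↦v) v⇝b))
        return record { node = v ; parent = s Tr e ; parent→node = e , refl , e↦v
                      ; node⊆C = v⊆C ; node⇝b = v⇝b ; parent⊈C = parent⊈C }

  FA-parent : ∀ {C u v} → u ≢ v → IsFA Tr C u → IsFA Tr C v → ¬ ¬ (∃ λ e → t Tr e ≡ u × ¬ LSub Tr (s Tr e) C)
  FA-parent _ (_ , inj₂ parent) _ = return parent
  FA-parent u≢v (_ , inj₁ u-root) (_ , inj₁ v-root) =
    ⊥-elim (u≢v (trans (rootT-unique _ u-root) (sym (rootT-unique _ v-root))))
  FA-parent {u = u} _ (u⊆C , inj₁ u-root) (_ , inj₂ (e , _ , parent⊈C)) = do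
    root⇝parent ← TreeAcyclicity.root-reaches rootT rootT-unique (s Tr e)
    let u⇝parent = subst (_⇝ᵀ s Tr e) (sym (rootT-unique u u-root)) root⇝parent
    ⊥-elim (parent⊈C λ x parent⇝x → u⊆C x (u⇝parent ++ᵀ parent⇝x))

  -- Let y be the FA node of C above b₀ and c ∈ C a leaf outside L(y). Explaining C needs a
  -- transfer edge into the region below y; its cycle and the cycle of e both pass the image
  -- of the parent of y, so the network would not be a galled tree.
  transfer-reaching-C-absurd : ∀ C → Explained C → ¬ IsClade Tr C → ∀ e → isS e ≡ false →
    ∀ {inner outer ℓ b₀} → Endpoint e inner → Endpoint e outer → ¬ F N isS C outer →
    inner ⇝ leaf N ℓ → ℓ ∉ C → outer ⇝ leaf N b₀ → b₀ ∈ C → ¬ ¬ ⊥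
  transfer-reaching-C-absurd C C-explained C-not-clade e e-transfer {inner} {outer} {ℓ} {b₀}
                             inner-end outer-end outer∉F inner⇝ℓ ℓ∉C outer⇝b₀ b₀∈C = do
    fa ← first-appearance C ℓ∉C b₀ b₀∈C
    let open FirstAppearance fa
    parent∈F ← ¬LSub⇒F C parent⊈C
    yes (c , c∈C , node⇏c) ← ¬¬-excluded-middle {A = ∃ λ c → c ∈ C × ¬ node ⇝ᵀ leaf Tr c}
      where no none → ⊥-elim (C-not-clade (node , λ x →
                        (λ x∈C → decidable-stable (T-reach? node (leaf Tr x)) λ node⇏x → none (x , x∈C , node⇏x))
                        , node⊆C x))
    let open Region (image-edge parent→node)
        b₀-in = below-c⇒inside node⇝b
    cr ← crossing-transfer C C-explained parent∈F b₀ b₀∈C b₀-in c c∈C λ c-in → inside⇒below-c c-in node⇏c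
    let open CrossingTransfer cr using (endpoints-∉F)
          renaming (edge to e′; transfer to e′-transfer; inner to inner′; outer to outer′; inner-endpoint to inner′-end;
                    outer-endpoint to outer′-end; inner-inside to inner′-in; outer-outside to outer′-out)
    outer-in ← reaches-inside⇒inside parent∈F outer∉F outer⇝b₀ b₀-in
    tc ← transfer-cycle e e-transfer
    tc′ ← transfer-cycle e′ e′-transfer
    let open TransferCycle
        apex-out : ¬ Inside (apex tc)
        apex-out apex-in =
          inside⇒below-c (apex-in ++ proj₁ (path-to-endpoint tc inner inner-end) ++ inner⇝ℓ) (ℓ∉C ∘ node⊆C ℓ)
        apex′-out : ¬ Inside (apex tc′)
        apex′-out apex-in = outer′-out (apex-in ++ proj₁ (path-to-endpoint tc′ outer′ outer′-end))
        different : ¬ SameEdges (graph N) (cycle tc) (cycle tc′)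
        different same =
          [ (λ e≡e′ → endpoints-∉F inner (subst (λ f → Endpoint f inner) e≡e′ inner-end) (ℓ , ℓ∉C , inner⇝ℓ))
          , transfer⇒¬support e-transfer ]′
          (other-edges tc′ e (proj₁ (same e) (e∈cycle tc)))
    φp∈c ← φp-on-transfer-cycle tc apex-out outer outer-end outer-in
    φp∈c′ ← φp-on-transfer-cycle tc′ apex′-out inner′ inner′-end inner′-in
    ⊥-elim (distinct-cycles-disjoint (cycle tc) (cycle tc′) different (φ parent) φp∈c φp∈c′)

  -- Explaining X needs a transfer edge out of the region below c; its outer endpoint reaches
  -- a leaf b₀, and b₀ ∈ C because that endpoint avoids F_X and X ∖ C lies inside the region.
  split-character-absurd : ∀ C → Explained C → ¬ IsClade Tr C → ∀ X → Explained X →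
    ∀ {p c S} → (∃ λ e → s Tr e ≡ p × t Tr e ≡ c) → ¬ LSub Tr p X → L Tr c S →
    ∀ {a b} → a ∈ X → a ∈ S → b ∈ X → b ∉ S →
    (∀ ℓ → ℓ ∈ S → ℓ ∉ C) → (∀ ℓ → ℓ ∈ X → ℓ ∉ S → ℓ ∈ C) → ¬ ¬ ⊥
  split-character-absurd C C-explained C-not-clade X X-explained {p} {S = S} p→c p⊈X S-clade {a} {b}
                         a∈X a∈S b∈X b∉S S∩C=∅ X∖S⊆C = do
    φp∈F ← ¬LSub⇒F X p⊈X
    cr ← crossing-transfer X X-explained φp∈F a a∈X (below-c⇒inside (proj₁ (S-clade a) a∈S)) b b∈X
           λ b-in → inside⇒below-c b-in (b∉S ∘ proj₂ (S-clade b))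
    escape φp∈F cr
    where
    open Region (image-edge p→c)
    escape : F N isS X (φ p) → CrossingTransfer X → ¬ ¬ ⊥
    escape φp∈F cr = do
      (b₀ , outer⇝b₀) ← reaches-leaf outer (transfer-endpoint-has-child edge transfer outer outer-endpoint)
      (ℓ , inner⇝ℓ) ← reaches-leaf inner (transfer-endpoint-has-child edge transfer inner inner-endpoint)
      c⇝ℓ ← inside⇒below-c (inner-inside ++ inner⇝ℓ)
      transfer-reaching-C-absurd C C-explained C-not-clade edge transfer inner-endpoint outer-endpoint outer∉F
        inner⇝ℓ (S∩C=∅ ℓ (proj₂ (S-clade ℓ) c⇝ℓ)) outer⇝b₀
        (decidable-stable (b₀ ∈? C) λ b₀∉C → outer∉F (b₀ , b₀∉C , outer⇝b₀))
      where
      open CrossingTransfer cr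
      outer∉F : ¬ F N isS C outer
      outer∉F = outer-∉F φp∈F cr λ x x∈X x∉C →
        below-c⇒inside (proj₁ (S-clade x) (decidable-stable (x ∈? S) λ x∉S → x∉C (X∖S⊆C x x∈X x∉S)))

x∈p─q⁻ : ∀ {m} (p q : Subset m) {x} → x ∈ p ─ q → x ∈ p × x ∉ q
x∈p─q⁻ (_ ∷ p) (true ∷ q) {zero} ()
x∈p─q⁻ (_ ∷ p) (false ∷ q) {zero} here = here , λ ()
x∈p─q⁻ (_ ∷ p) (_ ∷ q) {suc x} (there x∈p─q) with x∈p─q⁻ p q x∈p─q
... | x∈p , x∉q = there x∈p , λ { (there x∈q) → x∉q x∈q }

x∈p─q⁺ : ∀ {m} {p q : Subset m} {x} → x ∈ p → x ∉ q → x ∈ p ─ q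
x∈p─q⁺ {p = true ∷ p} {true ∷ q} here x∉q = ⊥-elim (x∉q here)
x∈p─q⁺ {p = true ∷ p} {false ∷ q} here x∉q = here
x∈p─q⁺ {p = _ ∷ p} {_ ∷ q} (there x∈p) x∉q = there (x∈p─q⁺ x∈p (x∉q ∘ there))

lemma12 : ∀ {n} (𝒞 : Subset n → Set) (A : Subset n) → IsMaximal 𝒞 A →
    (T : LNet n) → IsTree (graph T) → HasLeafSet (graph T) (leaf T) → NoSubdiv T →
    GalledCompletable T 𝒞 →
    (A₁ A₂ : Subset n) → SplitInto T A A₁ A₂ →
    (k : ℕ) (X : Fin (suc k) → Subset n) → IsChainOrdering 𝒞 A A₁ A₂ k X →
    ∀ C → 𝒞 C → ¬ Crossing 𝒞 A₁ A₂ C →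
    ((X zero ∩ A₁) ⊆ C ⊎ A₂ ⊆ C) → IsClade T C
lemma12 𝒞 A (𝒞A , _) Tr T-tree T-leaves _ (N , isS , lgt , galled , N-leaves , base , explains) A₁ A₂
  (x₁ , x₂ , x₁≢x₂ , FA₁ , FA₂ , _ , L₁ , L₂) k X (X-crossing , _ , _ , X-last≡A , _ , _ , X─A₁≡A₂) C 𝒞C C∉𝒳 covers =
  decidable-stable (IsClade? C) λ C-not-clade → case-split C-not-clade (X-crossing zero) covers λ ()
  where
  open Network Tr T-tree T-leaves N isS lgt galled N-leaves base
  X₁ = X zero

  A─A₁≡A₂ : A ─ A₁ ≡ A₂
  A─A₁≡A₂ = subst (λ Z → Z ─ A₁ ≡ A₂) X-last≡A (X─A₁≡A₂ (fromℕ k))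

  X₁─A₁⊆A₂ : ∀ {ℓ} → ℓ ∈ X₁ → ℓ ∉ A₁ → ℓ ∈ A₂
  X₁─A₁⊆A₂ {ℓ} ℓ∈X₁ ℓ∉A₁ = subst (ℓ ∈_) (X─A₁≡A₂ zero) (x∈p─q⁺ ℓ∈X₁ ℓ∉A₁)

  A₂-∉A₁ : ∀ {ℓ} → ℓ ∈ A₂ → ℓ ∉ A₁
  A₂-∉A₁ {ℓ} ℓ∈A₂ = proj₂ (x∈p─q⁻ A A₁ (subst (ℓ ∈_) (sym A─A₁≡A₂) ℓ∈A₂))

  side⊆A : ∀ {v S} → IsFA Tr A v → L Tr v S → S ⊆ A
  side⊆A (v⊆A , _) S-clade {ℓ} ℓ∈S = v⊆A ℓ (proj₁ (S-clade ℓ) ℓ∈S)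

  X₁⊆A : X₁ ⊆ A
  X₁⊆A {ℓ} ℓ∈X₁ = decidable-stable (ℓ ∈? A) λ ℓ∉A →
    ℓ∉A (side⊆A FA₂ L₂ (X₁─A₁⊆A₂ ℓ∈X₁ λ ℓ∈A₁ → ℓ∉A (side⊆A FA₁ L₁ ℓ∈A₁)))

  case-split : ¬ IsClade Tr C → Crossing 𝒞 A₁ A₂ X₁ → (X₁ ∩ A₁) ⊆ C ⊎ A₂ ⊆ C → ¬ ¬ ⊥
  case-split C-not-clade (_ , (a₁ , a₁∈X₁∩A₁) , (a₂ , a₂∈X₁∩A₂)) (inj₂ A₂⊆C) = do
    (e , e↦x₁ , parent⊈A) ← FA-parent x₁≢x₂ FA₁ FA₂
    let a₁∈A₁ = proj₂ (x∈p∩q⁻ X₁ A₁ a₁∈X₁∩A₁)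
        a₂∈A₂ = proj₂ (x∈p∩q⁻ X₁ A₂ a₂∈X₁∩A₂)
    split-character-absurd C (explains C 𝒞C) C-not-clade A (explains A 𝒞A) (e , refl , e↦x₁) parent⊈A L₁
      (side⊆A FA₁ L₁ a₁∈A₁) a₁∈A₁ (side⊆A FA₂ L₂ a₂∈A₂) (A₂-∉A₁ a₂∈A₂)
      (λ ℓ ℓ∈A₁ ℓ∈C → C∉𝒳 (𝒞C , (ℓ , x∈p∩q⁺ (ℓ∈C , ℓ∈A₁)) , (a₂ , x∈p∩q⁺ (A₂⊆C a₂∈A₂ , a₂∈A₂))))
      (λ ℓ ℓ∈A ℓ∉A₁ → A₂⊆C (subst (ℓ ∈_) A─A₁≡A₂ (x∈p─q⁺ ℓ∈A ℓ∉A₁)))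
  case-split C-not-clade (𝒞X₁ , (a₁ , a₁∈X₁∩A₁) , (a₂ , a₂∈X₁∩A₂)) (inj₁ X₁∩A₁⊆C) = do
    (e , e↦x₂ , parent⊈A) ← FA-parent (x₁≢x₂ ∘ sym) FA₂ FA₁
    let a₁∈X₁ , a₁∈A₁ = x∈p∩q⁻ X₁ A₁ a₁∈X₁∩A₁
        a₂∈X₁ , a₂∈A₂ = x∈p∩q⁻ X₁ A₂ a₂∈X₁∩A₂
    split-character-absurd C (explains C 𝒞C) C-not-clade X₁ (explains X₁ 𝒞X₁) (e , refl , e↦x₂)
      (λ parent⊆X₁ → parent⊈A λ ℓ parent⇝ℓ → X₁⊆A (parent⊆X₁ ℓ parent⇝ℓ)) L₂
      a₂∈X₁ a₂∈A₂ a₁∈X₁ (λ a₁∈A₂ → A₂-∉A₁ a₁∈A₂ a₁∈A₁)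
      (λ ℓ ℓ∈A₂ ℓ∈C → C∉𝒳 (𝒞C , (a₁ , x∈p∩q⁺ (X₁∩A₁⊆C a₁∈X₁∩A₁ , a₁∈A₁)) , (ℓ , x∈p∩q⁺ (ℓ∈C , ℓ∈A₂))))
      (λ ℓ ℓ∈X₁ ℓ∉A₂ → decidable-stable (ℓ ∈? C) λ ℓ∉C →
         ℓ∉A₂ (X₁─A₁⊆A₂ ℓ∈X₁ λ ℓ∈A₁ → ℓ∉C (X₁∩A₁⊆C (x∈p∩q⁺ (ℓ∈X₁ , ℓ∈A₁)))))
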